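{- Let $\mathfrak p_1,\mathfrak p_2\in L_{n,m}$ have height sequences $(h^{(1)}_1,\dots,h^{(1)}_n)$ and $(h^{(2)}_1,\dots,h^{(2)}_n)$, write $\{i\in[n]\mid h^{(1)}_i>h^{(2)}_i\}=\{i_1<i_2<\dots<i_s\}$ and set $i_0=0$. Then the relative pseudocomplement $\mathfrak p_1\to\mathfrak p_2$ in $\mathcal{L}_{n,m}$ is the path with height sequence $(h_1,\dots,h_n)$ where $h_{i_{k-1}+1}=h_{i_{k-1}+2}=\dots=h_{i_k}=h^{(2)}_{i_k}$ for each $k\in[s]$, and, if $i_s<n$, additionally $h_i=m$ for all $i_s<i\le n$.
   Context: $L_{n,m}$ is the set of lattice paths from $(0,0)$ to $(n,m)$ using up-steps $(0,1)$ and right-steps $(1,0)$; each is determined by its height sequence $(h_1,\dots,h_n)$ ($h_i$ = number of up-steps before the $i$-th right-step), and these are exactly the sequences $0\le h_1\le\dots\le h_n\le m$. $\mathcal{L}_{n,m}$ is $L_{n,m}$ ordered componentwise by height sequences; meet is componentwise min. The relative pseudocomplement $x\to y$ is the greatest $z$ with $x\wedge z\le y$. -}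

module Defs where

open import Data.Nat using (ℕ; _≤_; _<_; _⊓_)
open import Data.Nat.Properties using (⊓-mono-≤; ≤-trans; m⊓n≤m)
open import Data.Fin using (Fin)
import Data.Fin as F
open import Data.Product using (Σ; _×_; ∃-syntax)
open import Data.Sum using (_⊎_)
open import Relation.Nullary using (¬_)
open import Relation.Binary.PropositionalEquality using (_≡_)

-- A lattice path in L_{n,m}, given by its height sequence (h_1,…,h_n),
-- indexed by Fin n (index i : Fin n stands for i+1 ∈ [n]),
-- with 0 ≤ h_1 ≤ … ≤ h_n ≤ m.
record Path (n m : ℕ) : Set where
  constructor mkPath
  field
    height : Fin n → ℕ
    mono   : ∀ {i j : Fin n} → i F.≤ j → height i ≤ height j
    bound  : ∀ (i : Fin n) → height i ≤ m
open Path public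

_≼_ : ∀ {n m} → Path n m → Path n m → Set
p ≼ q = ∀ i → height p i ≤ height q i

_∧_ : ∀ {n m} → Path n m → Path n m → Path n m
p ∧ q = mkPath (λ i → height p i ⊓ height q i)
               (λ i≤j → ⊓-mono-≤ (mono p i≤j) (mono q i≤j))
               (λ i → ≤-trans (m⊓n≤m (height p i) (height q i)) (bound p i))

IsRelPseudocomplement : ∀ {n m} → Path n m → Path n m → Path n m → Set
IsRelPseudocomplement x y z = ((x ∧ z) ≼ y) × (∀ w → (x ∧ w) ≼ y → w ≼ z)

Desc : ∀ {n m} → Path n m → Path n m → Fin n → Set
Desc p₁ p₂ i = height p₂ i < height p₁ i

-- The height sequence described in Corollary 3.2: for i with
-- i_{k-1} < i ≤ i_k, h_i = h^(2)_{i_k}, i.e. i_k is the least element of the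
-- descent set that is ≥ i; if no element of the descent set is ≥ i
-- (i.e. i_s < i ≤ n), then h_i = m.
CorHeights : ∀ {n m} → Path n m → Path n m → (Fin n → ℕ) → Set
CorHeights {n} {m} p₁ p₂ h = ∀ (i : Fin n) →
    (∃[ j ] (i F.≤ j × Desc p₁ p₂ j
             × (∀ (k : Fin n) → i F.≤ k → k F.< j → ¬ Desc p₁ p₂ k)
             × h i ≡ height p₂ j))
  ⊎ ((∀ (j : Fin n) → i F.≤ j → ¬ Desc p₁ p₂ j) × h i ≡ m)

-- Pointwise, the relative pseudocomplement of a in the chain 0 ≤ … ≤ m is b when b < a and m
-- otherwise.  A path w satisfies p₁ ∧ w ≼ p₂ iff its heights lie below these pointwise values, and
-- since heights are monotone this says w_i ≤ min_{j ≥ i} of them.  So p₁ → p₂ is the suffix minimum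
-- of the pointwise pseudocomplements; at i it is attained at the first descent i_k ≥ i (earlier
-- positions contribute m, later descents are no lower because p₂ is monotone), or is m if none exists.
module Submission where

open import Defs
open import Function using (_∘_)
open import Data.Nat using (ℕ; zero; suc; _≤_; _<_; _⊓_; _<?_; z≤n; s≤s)
open import Data.Nat.Properties
  using (≤-refl; ≤-trans; ≤-antisym; <⇒≱; ≮⇒≥; ⊓-glb; ⊓-monoʳ-≤; m⊓n≤m; m⊓n≤n; m≤n⇒m⊓n≡m; m≥n⇒m⊓n≡n; ≤-total)
open import Data.Fin using (Fin; zero; suc)
import Data.Fin as F
import Data.Fin.Properties as F
open import Data.Product using (Σ; _×_; _,_; ∃-syntax)
open import Data.Sum using (_⊎_; inj₁; inj₂)
open import Relation.Nullary using (¬_; Dec; yes; no; contradiction)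
open import Relation.Nullary.Decidable using (_×-dec_)
open import Relation.Unary using (Pred; Decidable)
open import Relation.Binary.PropositionalEquality using (subst)

least-or-none : ∀ {n p} {P : Pred (Fin n) p} → Decidable P →
  (∃[ j ] P j × (∀ k → k F.< j → ¬ P k)) ⊎ (∀ j → ¬ P j)
least-or-none {zero} P? = inj₂ λ ()
least-or-none {suc n} P? with P? zero
... | yes p = inj₁ (zero , p , λ _ ())
... | no ¬p with least-or-none (P? ∘ suc)
...   | inj₁ (j , pj , below) = inj₁ (suc j , pj , λ { zero _ → ¬p ; (suc k) (s≤s k<j) → below k k<j })
...   | inj₂ none = inj₂ λ { zero → ¬p ; (suc j) → none j }

⊓-≤⇒≤ : ∀ {a b x} → b < a → a ⊓ x ≤ b → x ≤ b
⊓-≤⇒≤ {a} {b} {x} b<a a⊓x≤b with ≤-total x a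
... | inj₁ x≤a = subst (_≤ b) (m≥n⇒m⊓n≡n x≤a) a⊓x≤b
... | inj₂ a≤x = contradiction (subst (_≤ b) (m≤n⇒m⊓n≡m a≤x) a⊓x≤b) (<⇒≱ b<a)

chainImp : ℕ → ℕ → ℕ → ℕ
chainImp top a b with b <? a
... | yes _ = b
... | no _  = top

chainImp≤top : ∀ {top} a {b} → b ≤ top → chainImp top a b ≤ top
chainImp≤top a {b} b≤top with b <? a
... | yes _ = b≤top
... | no _  = ≤-refl

⊓-chainImp : ∀ top a b → a ⊓ chainImp top a b ≤ b
⊓-chainImp top a b with b <? a
... | yes _   = m⊓n≤n a b
... | no b≮a = ≤-trans (m⊓n≤m a top) (≮⇒≥ b≮a)

≤-chainImp : ∀ {top a b x} → x ≤ top → a ⊓ x ≤ b → x ≤ chainImp top a b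
≤-chainImp {top} {a} {b} x≤top a⊓x≤b with b <? a
... | yes b<a = ⊓-≤⇒≤ b<a a⊓x≤b
... | no _    = x≤top

infimum : ∀ {n} → ℕ → (Fin n → ℕ) → ℕ
infimum {zero}  top f = top
infimum {suc n} top f = f zero ⊓ infimum top (f ∘ suc)

infimum≤top : ∀ {n} top (f : Fin n → ℕ) → infimum top f ≤ top
infimum≤top {zero}  top f = ≤-refl
infimum≤top {suc n} top f = ≤-trans (m⊓n≤n _ _) (infimum≤top top (f ∘ suc))

infimum-≤ : ∀ {n} top (f : Fin n → ℕ) j → infimum top f ≤ f j
infimum-≤ top f zero    = m⊓n≤m _ _
infimum-≤ top f (suc j) = ≤-trans (m⊓n≤n _ _) (infimum-≤ top (f ∘ suc) j)

infimum-glb : ∀ {n top x} (f : Fin n → ℕ) → x ≤ top → (∀ j → x ≤ f j) → x ≤ infimum top f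
infimum-glb {zero}  f x≤top x≤f = x≤top
infimum-glb {suc n} f x≤top x≤f = ⊓-glb (x≤f zero) (infimum-glb (f ∘ suc) x≤top (x≤f ∘ suc))

suffixMin : ∀ {n} → ℕ → (Fin n → ℕ) → Fin n → ℕ
suffixMin top f zero    = infimum top f
suffixMin top f (suc i) = suffixMin top (f ∘ suc) i

suffixMin≤top : ∀ {n} top (f : Fin n → ℕ) i → suffixMin top f i ≤ top
suffixMin≤top top f zero    = infimum≤top top f
suffixMin≤top top f (suc i) = suffixMin≤top top (f ∘ suc) i

suffixMin-≤ : ∀ {n} top (f : Fin n → ℕ) {i j} → i F.≤ j → suffixMin top f i ≤ f j
suffixMin-≤ top f {zero}  {j}     _         = infimum-≤ top f j
suffixMin-≤ top f {suc i} {suc j} (s≤s i≤j) = suffixMin-≤ top (f ∘ suc) i≤j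

suffixMin-glb : ∀ {n top x} (f : Fin n → ℕ) i → x ≤ top → (∀ j → i F.≤ j → x ≤ f j) →
  x ≤ suffixMin top f i
suffixMin-glb f zero    x≤top x≤f = infimum-glb f x≤top (λ j → x≤f j z≤n)
suffixMin-glb f (suc i) x≤top x≤f = suffixMin-glb (f ∘ suc) i x≤top (λ j i≤j → x≤f (suc j) (s≤s i≤j))

suffixMin-mono : ∀ {n} top (f : Fin n → ℕ) {i j} → i F.≤ j → suffixMin top f i ≤ suffixMin top f j
suffixMin-mono top f {i} {j} i≤j =
  suffixMin-glb f j (suffixMin≤top top f i) (λ k j≤k → suffixMin-≤ top f (≤-trans i≤j j≤k))

module _ {n m : ℕ} (p₁ p₂ : Path n m) where

  heightImp : Fin n → ℕ
  heightImp j = chainImp m (height p₁ j) (height p₂ j)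

  pseudocomplement : Path n m
  pseudocomplement = mkPath (suffixMin m heightImp) (suffixMin-mono m heightImp) (suffixMin≤top m heightImp)

  meet-pseudocomplement-≼ : (p₁ ∧ pseudocomplement) ≼ p₂
  meet-pseudocomplement-≼ i =
    ≤-trans (⊓-monoʳ-≤ (height p₁ i) (suffixMin-≤ m heightImp ≤-refl)) (⊓-chainImp m _ _)

  ≤-pseudocomplement : ∀ {x} i → x ≤ m → (∀ j → i F.≤ j → height p₁ j ⊓ x ≤ height p₂ j) →
    x ≤ height pseudocomplement i
  ≤-pseudocomplement i x≤m meet≤ = suffixMin-glb heightImp i x≤m (λ j i≤j → ≤-chainImp x≤m (meet≤ j i≤j))

  pseudocomplement-greatest : ∀ w → (p₁ ∧ w) ≼ p₂ → w ≼ pseudocomplement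
  pseudocomplement-greatest w w-below i = ≤-pseudocomplement i (bound w i) λ j i≤j →
    ≤-trans (⊓-monoʳ-≤ (height p₁ j) (mono w i≤j)) (w-below j)

  pseudocomplement-heights : CorHeights p₁ p₂ (height pseudocomplement)
  pseudocomplement-heights i with least-or-none (λ j → (i F.≤? j) ×-dec (height p₂ j <? height p₁ j))
  ... | inj₁ (j , (i≤j , desc) , below) =
    inj₁ (j , i≤j , desc , (λ k i≤k k<j desc-k → below k k<j (i≤k , desc-k)) ,
          ≤-antisym at-most at-least)
    where
    at-most : height pseudocomplement i ≤ height p₂ j
    at-most = ≤-trans (mono pseudocomplement i≤j) (⊓-≤⇒≤ desc (meet-pseudocomplement-≼ j))
    at-least : height p₂ j ≤ height pseudocomplement i
    at-least = ≤-pseudocomplement i (bound p₂ j) λ k i≤k → meet-≤ k i≤k (k F.<? j)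
      where
      meet-≤ : ∀ k → i F.≤ k → Dec (k F.< j) → height p₁ k ⊓ height p₂ j ≤ height p₂ k
      meet-≤ k i≤k (yes k<j) = ≤-trans (m⊓n≤m _ _) (≮⇒≥ λ desc-k → below k k<j (i≤k , desc-k))
      meet-≤ k i≤k (no k≮j)  = ≤-trans (m⊓n≤n _ _) (mono p₂ (≮⇒≥ k≮j))
  ... | inj₂ none =
    inj₂ (no-desc , ≤-antisym (bound pseudocomplement i)
                       (≤-pseudocomplement i ≤-refl λ k i≤k → ≤-trans (m⊓n≤m _ _) (≮⇒≥ (no-desc k i≤k))))
    where
    no-desc : ∀ k → i F.≤ k → ¬ Desc p₁ p₂ k
    no-desc k i≤k desc-k = none k (i≤k , desc-k)

corollary3p2 : ∀ (n m : ℕ) (p₁ p₂ : Path n m) →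
    Σ (Path n m) (λ z → IsRelPseudocomplement p₁ p₂ z × CorHeights p₁ p₂ (height z))
corollary3p2 n m p₁ p₂ =
  pseudocomplement p₁ p₂ ,
  (meet-pseudocomplement-≼ p₁ p₂ , pseudocomplement-greatest p₁ p₂) ,
  pseudocomplement-heights p₁ p₂
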